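{- Let $\pi$ be a permutation of $[n]$, let $\tau$ be an assignment of types in $\{\mathrm{Q},\mathrm{S}\}$ to piles, and let $\rho:[n]\to\mathbb{N}$ with $\rho(1)=1$ be such that $(\tau,\rho)$ sorts $\pi$. Define $\rho^*$ by $$\rho^*(1)=1,\qquad \rho^*(s+1)=\rho^*(s)+\big[\pi(s+1)\prec_{\tau(\rho^*(s))}\pi(s)\big]\quad(s\in[n-1]),$$ where $i\prec_{\mathrm{Q}} j\iff i<j$ and $i\prec_{\mathrm{S}} j\iff i>j$. Then $\rho(s)\ge\rho^*(s)$ for all $s\in[n]$.
   Context: A deck of cards labelled by $[n]$ is represented by a permutation $\pi$ of $[n]$ with $\pi(s)$ the position (from the top) of label $s$. Label $s$ is dealt to the $\rho(s)$-th pile collected; pile $p$ has type $\tau(p)\in\{\mathrm{Q},\mathrm{S}\}$ (queue preserves placement order, stack reverses it). With $\chi(p)=[\tau(p)=\mathrm{S}]$, the heterogeneous shuffle of $\pi$ with $(\tau,\rho)$ is the unique permutation $\sigma$ of $[n]$ with $\sigma(s)<\sigma(t)$ iff $\big(\rho(s),(-1)^{\chi(\rho(s))}\pi(s)\big)<\big(\rho(t),(-1)^{\chi(\rho(t))}\pi(t)\big)$ lexicographically; $(\tau,\rho)$ sorts $\pi$ if $\sigma$ is the identity. $[P]$ is the indicator of $P$. -}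

module Defs where

open import Data.Nat using (ℕ; zero; suc; _+_; _<_; _>_; _<?_; _>?_)
open import Data.Nat.Properties using (<-trans; n<1+n)
open import Data.Integer as ℤ using (ℤ; +_; -_)
open import Data.Fin using (Fin; toℕ; fromℕ<)
open import Data.Fin.Permutation using (Permutation′; _⟨$⟩ʳ_)
open import Data.Product using (_×_; _,_)
open import Data.Sum using (_⊎_)
open import Data.Bool using (if_then_else_)
open import Relation.Nullary using (does)
open import Relation.Binary.PropositionalEquality using (_≡_)

-- Labels are Fin n (label s of the paper is toℕ s + 1); positions are
-- 0-based (π ⟨$⟩ʳ s); piles are indexed by ℕ (the paper uses 1, 2, ...).

data PileType : Set where
  Q S : PileType

-- χ(p) = [τ(p) = S], used as the sign (-1)^χ(p)
signed : PileType → ℕ → ℤ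
signed Q i = + i
signed S i = - (+ i)

key : ∀ {n} → Permutation′ n → (ℕ → PileType) → (Fin n → ℕ) → Fin n → ℕ × ℤ
key π τ ρ s = (ρ s , signed (τ (ρ s)) (toℕ (π ⟨$⟩ʳ s)))

_<lex_ : ℕ × ℤ → ℕ × ℤ → Set
(a , x) <lex (b , y) = a < b ⊎ (a ≡ b × x ℤ.< y)

-- the heterogeneous shuffle σ is characterised by
-- σ(s) < σ(t) ⇔ key(s) <lex key(t); (τ , ρ) sorts π iff σ is the identity,
-- i.e. iff the identity satisfies this characterisation.
Sorts : ∀ {n} → Permutation′ n → (ℕ → PileType) → (Fin n → ℕ) → Set
Sorts π τ ρ = ∀ s t →
  (toℕ s < toℕ t → key π τ ρ s <lex key π τ ρ t) ×
  (key π τ ρ s <lex key π τ ρ t → toℕ s < toℕ t)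

precInd : PileType → ℕ → ℕ → ℕ
precInd Q i j = if does (i <? j) then 1 else 0
precInd S i j = if does (i >? j) then 1 else 0

-- ρ*(k+1) for 0-based label index k < n
rhoStarAt : ∀ {n} → Permutation′ n → (ℕ → PileType) → (k : ℕ) → k < n → ℕ
rhoStarAt π τ zero p = 1
rhoStarAt π τ (suc k) p =
  let q = <-trans (n<1+n k) p
      r = rhoStarAt π τ k q
  in r + precInd (τ r) (toℕ (π ⟨$⟩ʳ fromℕ< p)) (toℕ (π ⟨$⟩ʳ fromℕ< q))

rhoStar : ∀ {n} → Permutation′ n → (ℕ → PileType) → Fin n → ℕ
rhoStar π τ s = rhoStarAt π τ (toℕ s) (Data.Fin.Properties.toℕ<n s)
  where import Data.Fin.Properties

-- Between consecutive labels ρ* grows by at most 1,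
-- so ρ* can only overtake ρ at label s + 1 if ρ*(s) = ρ(s) = ρ(s + 1).  Then
-- labels s and s + 1 share the pile ρ*(s), and since the deal sorts π their
-- positions appear on that pile in the order dictated by its type, which is
-- exactly the case [π(s + 1) ≺ π(s)] = 0.
module Submission where

open import Defs
open import Data.Nat using (ℕ; zero; suc; _+_; _≤_; _<_; _<?_; s≤s; z≤n)
open import Data.Nat.Properties
  using (≤-refl; ≤-reflexive; ≤-trans; <-trans; <-asym; n<1+n; +-comm; +-identityʳ;
         +-monoʳ-≤; m≤n⇒m<n∨m≡n)
import Data.Integer as ℤ
open import Data.Integer.Properties using (drop‿+<+; neg-cancel-<)
open import Data.Fin using (Fin; toℕ; fromℕ<)
open import Data.Fin.Properties using (toℕ-fromℕ<; fromℕ<-toℕ; toℕ<n)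
open import Data.Fin.Permutation using (Permutation′)
open import Data.Bool using (Bool; true; false; if_then_else_)
open import Data.Product using (_,_; proj₁)
open import Data.Sum using (inj₁; inj₂)
open import Relation.Nullary.Decidable using (dec-false)
open import Relation.Binary.PropositionalEquality
  using (_≡_; refl; sym; trans; cong; subst; subst₂)

indicator≤1 : ∀ (b : Bool) → (if b then 1 else 0) ≤ 1
indicator≤1 true  = ≤-refl
indicator≤1 false = z≤n

precInd≤1 : ∀ T i j → precInd T i j ≤ 1
precInd≤1 Q i j = indicator≤1 _
precInd≤1 S i j = indicator≤1 _

+precInd≤suc : ∀ r T i j → r + precInd T i j ≤ suc r
+precInd≤suc r T i j =
  subst (r + precInd T i j ≤_) (+-comm r 1) (+-monoʳ-≤ r (precInd≤1 T i j))

signed<⇒precInd≡0 : ∀ T i j → signed T j ℤ.< signed T i → precInd T i j ≡ 0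
signed<⇒precInd≡0 Q i j lt
  rewrite dec-false (i <? j) (<-asym (drop‿+<+ lt)) = refl
signed<⇒precInd≡0 S i j lt
  rewrite dec-false (j <? i) (<-asym (drop‿+<+ (neg-cancel-< lt))) = refl

-- r is ρ*(s), and the lexicographic hypothesis is key(s) <lex key(s + 1)
-- with a = ρ(s), b = ρ(s + 1), j = π(s), i = π(s + 1).
precInd-step-≤ : ∀ (τ : ℕ → PileType) {r a b i j} → r ≤ a →
                 (a , signed (τ a) j) <lex (b , signed (τ b) i) →
                 r + precInd (τ r) i j ≤ b
precInd-step-≤ τ {r} {i = i} {j} r≤a (inj₁ a<b) =
  ≤-trans (+precInd≤suc r (τ r) i j) (≤-trans (s≤s r≤a) a<b)
precInd-step-≤ τ {r} {i = i} {j} r≤a (inj₂ (refl , lt)) with m≤n⇒m<n∨m≡n r≤a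
... | inj₁ r<a  = ≤-trans (+precInd≤suc r (τ r) i j) r<a
... | inj₂ refl =
  ≤-reflexive (trans (cong (r +_) (signed<⇒precInd≡0 (τ r) i j lt)) (+-identityʳ r))

rhoStarAt≤ρ : ∀ {n} (π : Permutation′ n) (τ : ℕ → PileType) (ρ : Fin n → ℕ) →
              (∀ s → toℕ s ≡ 0 → ρ s ≡ 1) → Sorts π τ ρ →
              ∀ k (k<n : k < n) → rhoStarAt π τ k k<n ≤ ρ (fromℕ< k<n)
rhoStarAt≤ρ π τ ρ ρ-first sorts zero 0<n =
  ≤-reflexive (sym (ρ-first (fromℕ< 0<n) (toℕ-fromℕ< 0<n)))
rhoStarAt≤ρ π τ ρ ρ-first sorts (suc k) k+1<n =
  precInd-step-≤ τ (rhoStarAt≤ρ π τ ρ ρ-first sorts k k<n)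
                   (proj₁ (sorts (fromℕ< k<n) (fromℕ< k+1<n)) consecutive)
  where
  k<n = <-trans (n<1+n k) k+1<n
  consecutive : toℕ (fromℕ< k<n) < toℕ (fromℕ< k+1<n)
  consecutive = subst₂ _<_ (sym (toℕ-fromℕ< k<n)) (sym (toℕ-fromℕ< k+1<n)) (n<1+n k)

lemma8 : (n : ℕ) (π : Permutation′ n) (τ : ℕ → PileType) (ρ : Fin n → ℕ) →
         (∀ (s : Fin n) → toℕ s ≡ 0 → ρ s ≡ 1) →
         Sorts π τ ρ →
         ∀ (s : Fin n) → rhoStar π τ s ≤ ρ s
lemma8 n π τ ρ ρ-first sorts s =
  subst (λ t → rhoStar π τ s ≤ ρ t) (fromℕ<-toℕ s (toℕ<n s))
        (rhoStarAt≤ρ π τ ρ ρ-first sorts (toℕ s) (toℕ<n s))
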